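{- For all integers $k\ge1$, $$G^P_{k_d}-G^P_{k_c}=E^P_{k_d}=dq^k\left(E^P_{k_c}+E^P_{k_a}+G^P_{(k-1)_c}\right),$$ $$G^P_{k_c}-G^P_{k_b}=E^P_{k_c}=cq^k\left(E^P_{k_c}+E^P_{k_a}+G^P_{(k-1)_c}\right),$$ $$G^P_{k_b}-G^P_{k_a}=E^P_{k_b}=bq^k\left(E^P_{k_b}+G^P_{(k-1)_d}\right),$$ $$G^P_{k_a}-G^P_{(k-1)_d}=E^P_{k_a}=aq^k\left(E^P_{(k-1)_b}+G^P_{(k-2)_d}\right),$$ where for coloured integers of value $\le0$ the following conventions are used: $E^P_{0_a}=E^P_{0_c}=E^P_{0_d}=0$, $E^P_{0_b}=b$, $G^P_{0_b}=G^P_{0_c}=G^P_{0_d}=1$, $G^P_{0_a}=G^P_{(-1)_d}=1-b$.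
   Context: A coloured integer $m_x$ is a positive integer $m$ with colour $x\in\{a,b,c,d\}$, totally ordered by $1_a<1_b<1_c<1_d<2_a<2_b<2_c<2_d<\cdots$. Let $\mathcal{P}$ be the set of finite non-increasing (in this order, possibly empty) sequences of coloured positive integers such that consecutive parts $m_x$ (larger) and $m'_y$ (next) satisfy $m-m'\ge P(x,y)$, where $P(a,a)=2,P(a,b)=1,P(a,c)=2,P(a,d)=2$; $P(b,a)=1,P(b,b)=0,P(b,c)=1,P(b,d)=1$; $P(c,a)=0,P(c,b)=1,P(c,c)=0,P(c,d)=2$; $P(d,a)=0,P(d,b)=1,P(d,c)=0,P(d,d)=2$. For a coloured positive integer $z$, $G^P_z$ (resp. $E^P_z$) is $\sum_\lambda q^{|\lambda|}a^{\#_a}b^{\#_b}c^{\#_c}d^{\#_d}$ over $\lambda\in\mathcal{P}$ whose largest part is at most $z$ (resp. equal to $z$) in this order, the empty partition counting as having largest part at most $z$; $|\lambda|$ is the sum of values and $\#_x$ the number of parts of colour $x$. -}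

module Defs where

open import Data.Nat as ℕ using (ℕ; zero; suc; _+_; _*_; _∸_; _≤_; _≤?_)
open import Data.Integer as ℤ using (ℤ; +_; -[1+_]; +[1+_])
open import Data.Product using (_×_; _,_; proj₁; proj₂)
open import Data.List using (List; []; _∷_; [_]; map; concatMap; upTo; filter; length)
open import Data.Nat.ListAction using (sum)
open import Data.List.Relation.Unary.All using (All; all?)
open import Data.List.Relation.Unary.Any using (Any; any?)
open import Data.List.Relation.Unary.Linked using (Linked; linked?)
open import Relation.Binary.PropositionalEquality using (_≡_)
open import Relation.Nullary.Decidable using (Dec; yes; no; _×-dec_)

data Colour : Set where
  ca cb cc cd : Colour

allColours : List Colour
allColours = ca ∷ cb ∷ cc ∷ cd ∷ []

colIdx : Colour → ℕ
colIdx ca = 0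
colIdx cb = 1
colIdx cc = 2
colIdx cd = 3

-- a coloured integer m_x : (value m , colour x); parts of partitions must
-- have positive value (enforced in the predicate below)
CInt : Set
CInt = ℕ × Colour

-- the total order 1_a<1_b<1_c<1_d<2_a<... is encoded by this key
key : CInt → ℕ
key (m , x) = 4 * m + colIdx x

_≤ᶜ_ : CInt → CInt → Set
p ≤ᶜ q = key p ≤ key q

P : Colour → Colour → ℕ
P ca ca = 2
P ca cb = 1
P ca cc = 2
P ca cd = 2
P cb ca = 1
P cb cb = 0
P cb cc = 1
P cb cd = 1
P cc ca = 0
P cc cb = 1
P cc cc = 0
P cc cd = 2
P cd ca = 0
P cd cb = 1
P cd cc = 0
P cd cd = 2

-- condition on consecutive parts m_x (larger, first) and m'_y (next):
-- non-increasing in the order, and m - m' ≥ P(x,y)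
Adj : CInt → CInt → Set
Adj (m , x) (m' , y) = ((m' , y) ≤ᶜ (m , x)) × (P x y + m' ≤ m)

Adj? : (p q : CInt) → Dec (Adj p q)
Adj? (m , x) (m' , y) = (key (m' , y) ≤? key (m , x)) ×-dec (P x y + m' ≤? m)

Positive : CInt → Set
Positive (m , _) = 1 ≤ m

-- membership in the set 𝒫 (partitions written largest part first)
InP : List CInt → Set
InP λs = All Positive λs × Linked Adj λs

InP? : (λs : List CInt) → Dec (InP λs)
InP? λs = all? (λ p → 1 ≤? proj₁ p) λs ×-dec linked? Adj? λs

size : List CInt → ℕ
size λs = sum (map proj₁ λs)

count : Colour → List CInt → ℕ
count x λs = length (filter (λ p → colIdx (proj₂ p) ℕ.≟ colIdx x) λs)

AtMost : CInt → List CInt → Set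
AtMost z λs = All (λ p → p ≤ᶜ z) λs

Largest : CInt → List CInt → Set
Largest z λs = AtMost z λs × Any (λ p → key p ≡ key z) λs

-- finite candidate set: all lists of coloured positive integers whose
-- values sum to n (first argument is fuel; gen n n is complete)

gen : ℕ → ℕ → List (List CInt)
gen _ zero = [ [] ]
gen zero (suc n) = []
gen (suc f) (suc n) =
  concatMap (λ v → concatMap (λ x → map ((suc v , x) ∷_) (gen f (n ∸ v))) allColours)
            (upTo (suc n))

candidates : ℕ → List (List CInt)
candidates n = gen n n

-- formal power series in q, a, b, c, d with integer coefficients:
-- S n i j l m = coefficient of q^n a^i b^j c^l d^m

Series : Set
Series = ℕ → ℕ → ℕ → ℕ → ℕ → ℤ

infix 4 _≈_
_≈_ : Series → Series → Set
F ≈ G = ∀ n i j l m → F n i j l m ≡ G n i j l m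

infixl 6 _⊕_ _⊖_
_⊕_ : Series → Series → Series
(F ⊕ G) n i j l m = F n i j l m ℤ.+ G n i j l m

_⊖_ : Series → Series → Series
(F ⊖ G) n i j l m = F n i j l m ℤ.- G n i j l m

private
  ifLe : ℕ → ℕ → ℤ → ℤ
  ifLe e n v with e ≤? n
  ... | yes _ = v
  ... | no _ = + 0

-- multiplication by the monomial q^e a^ea b^eb c^ec d^ed
mon : ℕ → ℕ → ℕ → ℕ → ℕ → Series → Series
mon e ea eb ec ed F n i j l m =
  ifLe e n (ifLe ea i (ifLe eb j (ifLe ec l (ifLe ed m
    (F (n ∸ e) (i ∸ ea) (j ∸ eb) (l ∸ ec) (m ∸ ed))))))

one : Series
one 0 0 0 0 0 = + 1
one _ _ _ _ _ = + 0

bSer : Series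
bSer = mon 0 0 1 0 0 one

zeroS : Series
zeroS _ _ _ _ _ = + 0

Stat : ℕ → ℕ → ℕ → ℕ → ℕ → List CInt → Set
Stat n i j l m λs =
  (size λs ≡ n) × (count ca λs ≡ i) × (count cb λs ≡ j) × (count cc λs ≡ l) × (count cd λs ≡ m)

Stat? : ∀ n i j l m λs → Dec (Stat n i j l m λs)
Stat? n i j l m λs =
  (size λs ℕ.≟ n) ×-dec (count ca λs ℕ.≟ i) ×-dec (count cb λs ℕ.≟ j)
  ×-dec (count cc λs ℕ.≟ l) ×-dec (count cd λs ℕ.≟ m)

AtMost? : ∀ z λs → Dec (AtMost z λs)
AtMost? z λs = all? (λ p → key p ≤? key z) λs

Largest? : ∀ z λs → Dec (Largest z λs)
Largest? z λs = AtMost? z λs ×-dec any? (λ p → key p ℕ.≟ key z) λs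

GPpos : CInt → Series
GPpos z n i j l m =
  + length (filter (λ λs → InP? λs ×-dec AtMost? z λs ×-dec Stat? n i j l m λs) (candidates n))

EPpos : CInt → Series
EPpos z n i j l m =
  + length (filter (λ λs → InP? λs ×-dec Largest? z λs ×-dec Stat? n i j l m λs) (candidates n))

-- G^P and E^P for coloured integers with integer value, including the
-- paper's conventions for values ≤ 0.  Cases not covered by the paper's
-- conventions (never used in the lemma) are set to 0.

GP : ℤ → Colour → Series
GP +[1+ k ] x = GPpos (suc k , x)
GP (+ 0) ca = one ⊖ bSer
GP (+ 0) cb = one
GP (+ 0) cc = one
GP (+ 0) cd = one
GP -[1+ 0 ] cd = one ⊖ bSer
GP -[1+ _ ] _ = zeroS

EP : ℤ → Colour → Series
EP +[1+ k ] x = EPpos (suc k , x)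
EP (+ 0) cb = bSer
EP (+ 0) _ = zeroS
EP -[1+ _ ] _ = zeroS

-- The order on coloured integers is the order of the key 4m + idx(x) of m_x, so the partitions
-- with largest part at most z are those with largest part at most the predecessor z⁻ of z and
-- those with largest part exactly z: this is G_z − G_z⁻ = E_z.
-- Deleting the largest part p = m_x of a partition counted by E_p leaves an arbitrary partition
-- of 𝒫 that may follow p, so E_p is q^m x times the series of such followers.  For the parts p
-- of the lemma the possible next parts are a few parts of value m together with everything up
-- to a bound, which turns the series of followers into a sum of E's and one G.  The rows of P
-- for c and d coincide, so k_c and k_d have the same followers (k_c, k_a and everything up to
-- (k−1)_c), and P(a,y) = P(b,y) + 1 makes the followers of (k+1)_a those of k_b (k_b and
-- everything up to (k−1)_d).

module Submission where

open import Defs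
open import Data.Bool using (if_then_else_; true; false)
open import Data.Empty using (⊥; ⊥-elim)
open import Data.Integer as ℤ using (ℤ; +_; _-_)
open import Data.Integer.Tactic.RingSolver using (solve-∀)
open import Data.List using (List; []; _∷_; map; concatMap; filter; length; _++_; applyUpTo; upTo)
open import Data.List.Properties
  using (filter-++; length-++; filter-≐; filter-none; map-applyUpTo; concatMap-cong)
open import Data.List.Relation.Unary.All as All using (All; []; _∷_)
open import Data.List.Relation.Unary.Any using (Any; here; there)
open import Data.List.Relation.Unary.Linked as Linked using (Linked; [-]; _∷_; linked?)
open import Data.Nat as ℕ using (ℕ; zero; suc; _+_; _*_; _∸_; _≤_; _<_; _≤?_; z≤n; s≤s)
open import Data.Nat.ListAction using (sum)
open import Data.Nat.Properties
open import Data.Product using (_×_; _,_; proj₁; proj₂)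
open import Data.Product.Function.NonDependent.Propositional using (_×-⇔_)
open import Data.Sum as Sum using (_⊎_; inj₁; inj₂; [_,_]′)
open import Function using (_⇔_; mk⇔; Equivalence; _∘_; _∘′_; flip; id; case_of_)
open import Level using (0ℓ)
open import Relation.Binary.Definitions using (tri<; tri≈; tri>)
open import Relation.Binary.PropositionalEquality
open import Relation.Nullary using (¬_; yes; no; does; contradiction)
open import Relation.Nullary.Decidable using (_×-dec_)
open import Relation.Unary using (Pred; Decidable; _≐_; _∪_; ∅)
open import Relation.Unary.Properties using (_∪?_; ∅?)

countWhere : {A : Set} {P : Pred A 0ℓ} → Decidable P → List A → ℕ
countWhere P? xs = length (filter P? xs)

module _ {A : Set} where

  countWhere-≐ : {P Q : Pred A 0ℓ} (P? : Decidable P) (Q? : Decidable Q) →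
    P ≐ Q → ∀ xs → countWhere P? xs ≡ countWhere Q? xs
  countWhere-≐ P? Q? P≐Q xs = cong length (filter-≐ P? Q? P≐Q xs)

  countWhere-none : {P : Pred A 0ℓ} (P? : Decidable P) → (∀ x → ¬ P x) → ∀ xs → countWhere P? xs ≡ 0
  countWhere-none P? ¬P xs = cong length (filter-none P? (All.universal ¬P xs))

  countWhere-⊎ : {P Q R : Pred A 0ℓ} (P? : Decidable P) (Q? : Decidable Q) (R? : Decidable R) →
    P ≐ Q ∪ R → (∀ {x} → Q x → R x → ⊥) →
    ∀ xs → countWhere P? xs ≡ countWhere Q? xs + countWhere R? xs
  countWhere-⊎ P? Q? R? P≐Q∪R Q∩R=∅ [] = refl
  countWhere-⊎ P? Q? R? P≐Q∪R Q∩R=∅ (x ∷ xs)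
    with ih ← countWhere-⊎ P? Q? R? P≐Q∪R Q∩R=∅ xs | P? x | Q? x | R? x
  ... | yes _ | yes q | yes r = ⊥-elim (Q∩R=∅ q r)
  ... | yes _ | yes _ | no _  = cong suc ih
  ... | yes _ | no _  | yes _ = trans (cong suc ih) (sym (+-suc _ _))
  ... | yes p | no ¬q | no ¬r = [ flip contradiction ¬q , flip contradiction ¬r ]′ (proj₁ P≐Q∪R p)
  ... | no ¬p | yes q | _     = contradiction (proj₂ P≐Q∪R (inj₁ q)) ¬p
  ... | no ¬p | no _  | yes r = contradiction (proj₂ P≐Q∪R (inj₂ r)) ¬p
  ... | no _  | no _  | no _  = ih

  countWhere-map : {B : Set} {P : Pred A 0ℓ} (P? : Decidable P) (f : B → A) →
    ∀ xs → countWhere P? (map f xs) ≡ countWhere (λ y → P? (f y)) xs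
  countWhere-map P? f [] = refl
  countWhere-map P? f (x ∷ xs) with P? (f x)
  ... | yes _ = cong suc (countWhere-map P? f xs)
  ... | no _  = countWhere-map P? f xs

  countWhere-concatMap : {B : Set} {P : Pred A 0ℓ} (P? : Decidable P) (f : B → List A) →
    ∀ xs → countWhere P? (concatMap f xs) ≡ sum (map (countWhere P? ∘′ f) xs)
  countWhere-concatMap P? f [] = refl
  countWhere-concatMap P? f (x ∷ xs) = begin
      length (filter P? (f x ++ concatMap f xs))
    ≡⟨ cong length (filter-++ P? (f x) (concatMap f xs)) ⟩
      length (filter P? (f x) ++ filter P? (concatMap f xs))
    ≡⟨ length-++ (filter P? (f x)) ⟩
      countWhere P? (f x) + countWhere P? (concatMap f xs)
    ≡⟨ cong₂ _+_ refl (countWhere-concatMap P? f xs) ⟩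
      countWhere P? (f x) + sum (map (countWhere P? ∘′ f) xs)
    ∎
    where open ≡-Reasoning

sum-applyUpTo-zero : ∀ (f : ℕ → ℕ) m → (∀ v → f v ≡ 0) → sum (applyUpTo f m) ≡ 0
sum-applyUpTo-zero f zero    f≡0 = refl
sum-applyUpTo-zero f (suc m) f≡0 = cong₂ _+_ (f≡0 0) (sum-applyUpTo-zero (f ∘′ suc) m (f≡0 ∘ suc))

sum-applyUpTo-single : ∀ (f : ℕ → ℕ) {k m} → k < m → (∀ v → v ≢ k → f v ≡ 0) →
  sum (applyUpTo f m) ≡ f k
sum-applyUpTo-single f {zero} {suc m} _ f≡0 =
  trans (cong₂ _+_ refl (sum-applyUpTo-zero (f ∘′ suc) m (λ v → f≡0 (suc v) λ ()))) (+-identityʳ (f 0))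
sum-applyUpTo-single f {suc k} {suc m} (s≤s k<m) f≡0 =
  cong₂ _+_ (f≡0 0 λ ())
    (sum-applyUpTo-single (f ∘′ suc) k<m (λ v v≢k → f≡0 (suc v) (v≢k ∘′ suc-injective)))

sum-allColours-single : ∀ (g : Colour → ℕ) x → (∀ y → y ≢ x → g y ≡ 0) → sum (map g allColours) ≡ g x
sum-allColours-single g ca g≡0 rewrite g≡0 cb (λ ()) | g≡0 cc (λ ()) | g≡0 cd (λ ()) = +-identityʳ _
sum-allColours-single g cb g≡0 rewrite g≡0 ca (λ ()) | g≡0 cc (λ ()) | g≡0 cd (λ ()) = +-identityʳ _
sum-allColours-single g cc g≡0 rewrite g≡0 ca (λ ()) | g≡0 cb (λ ()) | g≡0 cd (λ ()) = +-identityʳ _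
sum-allColours-single g cd g≡0 rewrite g≡0 ca (λ ()) | g≡0 cb (λ ()) | g≡0 cc (λ ()) = +-identityʳ _

colIdx≤3 : ∀ x → colIdx x ≤ 3
colIdx≤3 ca = z≤n
colIdx≤3 cb = s≤s z≤n
colIdx≤3 cc = s≤s (s≤s z≤n)
colIdx≤3 cd = s≤s (s≤s (s≤s z≤n))

colourOf : ℕ → Colour
colourOf 0 = ca
colourOf 1 = cb
colourOf 2 = cc
colourOf _ = cd

colourOf-colIdx : ∀ x → colourOf (colIdx x) ≡ x
colourOf-colIdx ca = refl
colourOf-colIdx cb = refl
colourOf-colIdx cc = refl
colourOf-colIdx cd = refl

colIdx-injective : ∀ {x y} → colIdx x ≡ colIdx y → x ≡ y
colIdx-injective {x} {y} e =
  trans (sym (colourOf-colIdx x)) (trans (cong colourOf e) (colourOf-colIdx y))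

key-<-value : ∀ {m m'} x y → m < m' → key (m , x) < key (m' , y)
key-<-value {m} {m'} x y m<m' = begin-strict
    4 * m + colIdx x   <⟨ +-monoʳ-< (4 * m) (s≤s (colIdx≤3 x)) ⟩
    4 * m + 4          ≡⟨ +-comm (4 * m) 4 ⟩
    4 + 4 * m          ≡⟨ *-suc 4 m ⟨
    4 * suc m          ≤⟨ *-monoʳ-≤ 4 m<m' ⟩
    4 * m'             ≤⟨ m≤m+n (4 * m') (colIdx y) ⟩
    4 * m' + colIdx y  ∎
  where open ≤-Reasoning

key-injective : ∀ p q → key p ≡ key q → p ≡ q
key-injective (m , x) (m' , y) e with <-cmp m m'
... | tri< m<m' _ _ = contradiction e (<⇒≢ (key-<-value x y m<m'))
... | tri≈ _ refl _ = cong (m ,_) (colIdx-injective (+-cancelˡ-≡ (4 * m) _ _ e))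
... | tri> _ _ m>m' = contradiction e (>⇒≢ (key-<-value y x m>m'))

≤ᶜ-inv : ∀ m x m' y → (m , x) ≤ᶜ (m' , y) → m < m' ⊎ (m ≡ m' × colIdx x ≤ colIdx y)
≤ᶜ-inv m x m' y le with <-cmp m m'
... | tri< m<m' _ _ = inj₁ m<m'
... | tri≈ _ refl _ = inj₂ (refl , +-cancelˡ-≤ (4 * m) _ _ le)
... | tri> _ _ m>m' = contradiction le (<⇒≱ (key-<-value y x m>m'))

≤ᶜ⇒≤ : ∀ m x m' y → (m , x) ≤ᶜ (m' , y) → m ≤ m'
≤ᶜ⇒≤ m x m' y le with ≤ᶜ-inv m x m' y le
... | inj₁ m<m'       = <⇒≤ m<m'
... | inj₂ (refl , _) = ≤-refl

≤ᶜ-mono : ∀ {m m'} x y → m ≤ m' → colIdx x ≤ colIdx y → (m , x) ≤ᶜ (m' , y)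
≤ᶜ-mono {m} x y m≤m' x≤y with m≤n⇒m<n∨m≡n m≤m'
... | inj₁ m<m' = <⇒≤ (key-<-value x y m<m')
... | inj₂ refl = +-monoʳ-≤ (4 * m) x≤y

head-dominates : ∀ {q r} → Linked Adj (q ∷ r) → All (_≤ᶜ q) r
head-dominates [-]       = []
head-dominates (adj ∷ l) = proj₁ adj ∷ All.map (λ s≤q' → ≤-trans s≤q' (proj₁ adj)) (head-dominates l)

Head : Pred CInt 0ℓ → Pred (List CInt) 0ℓ
Head A []      = ⊥
Head A (q ∷ _) = A q

head? : {A : Pred CInt 0ℓ} → Decidable A → Decidable (Head A)
head? A? []      = no λ ()
head? A? (q ∷ _) = A? q

SameKey : CInt → Pred CInt 0ℓ
SameKey z q = key q ≡ key z

sameKey? : ∀ z → Decidable (SameKey z)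
sameKey? z q = key q ℕ.≟ key z

atMost-∷ : ∀ {z q r} → Linked Adj (q ∷ r) → q ≤ᶜ z → AtMost z (q ∷ r)
atMost-∷ l q≤z = q≤z ∷ All.map (λ s≤q → ≤-trans s≤q q≤z) (head-dominates l)

largest⇒head : ∀ {z} λs → Linked Adj λs → Largest z λs → Head (SameKey z) λs
largest⇒head (q ∷ r) l (q≤z ∷ _ , here q≡z)  = q≡z
largest⇒head (q ∷ r) l (q≤z ∷ _ , there s≡z) =
  ≤-antisym q≤z (All.lookupWith (λ s≤q s≡z → ≤-trans (≤-reflexive (sym s≡z)) s≤q) (head-dominates l) s≡z)

head⇒largest : ∀ {z} λs → Linked Adj λs → Head (SameKey z) λs → Largest z λs
head⇒largest {z} (q ∷ r) l q≡z = atMost-∷ {z} l (≤-reflexive q≡z) , here q≡z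

≈-refl : ∀ {F} → F ≈ F
≈-refl n i j l m = refl

≈-sym : ∀ {F G} → F ≈ G → G ≈ F
≈-sym F≈G n i j l m = sym (F≈G n i j l m)

≈-trans : ∀ {F G H} → F ≈ G → G ≈ H → F ≈ H
≈-trans F≈G G≈H n i j l m = trans (F≈G n i j l m) (G≈H n i j l m)

⊕-cong : ∀ {F F' G G'} → F ≈ F' → G ≈ G' → F ⊕ G ≈ F' ⊕ G'
⊕-cong F≈F' G≈G' n i j l m = cong₂ ℤ._+_ (F≈F' n i j l m) (G≈G' n i j l m)

⊖-congʳ : ∀ {F G G'} → G ≈ G' → F ⊖ G ≈ F ⊖ G'
⊖-congʳ {F} G≈G' n i j l m = cong (F n i j l m -_) (G≈G' n i j l m)

mon-cong : ∀ e ea eb ec ed {F G} → F ≈ G → mon e ea eb ec ed F ≈ mon e ea eb ec ed G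
mon-cong e ea eb ec ed F≈G n i j l m
  rewrite F≈G (n ∸ e) (i ∸ ea) (j ∸ eb) (l ∸ ec) (m ∸ ed) = refl

mon-intro : ∀ e ea eb ec ed F n i j l m {v : ℤ} →
  (e ≤ n → ea ≤ i → eb ≤ j → ec ≤ l → ed ≤ m → v ≡ F (n ∸ e) (i ∸ ea) (j ∸ eb) (l ∸ ec) (m ∸ ed)) →
  (¬ (e ≤ n × ea ≤ i × eb ≤ j × ec ≤ l × ed ≤ m) → v ≡ + 0) →
  v ≡ mon e ea eb ec ed F n i j l m
mon-intro e ea eb ec ed F n i j l m inside outside with e ≤? n | ea ≤? i | eb ≤? j | ec ≤? l | ed ≤? m
... | yes p | yes pa | yes pb | yes pc | yes pd = inside p pa pb pc pd
... | no ¬p | _      | _      | _      | _      = outside (¬p ∘ proj₁)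
... | yes _ | no ¬p  | _      | _      | _      = outside (¬p ∘ proj₁ ∘ proj₂)
... | yes _ | yes _  | no ¬p  | _      | _      = outside (¬p ∘ proj₁ ∘ proj₂ ∘ proj₂)
... | yes _ | yes _  | yes _  | no ¬p  | _      = outside (¬p ∘ proj₁ ∘ proj₂ ∘ proj₂ ∘ proj₂)
... | yes _ | yes _  | yes _  | yes _  | no ¬p  = outside (¬p ∘ proj₂ ∘ proj₂ ∘ proj₂ ∘ proj₂)

-- GPpos z and EPpos z are definitionally PSeries (AtMost? z) and PSeries (Largest? z).
PSeries : {Q : Pred (List CInt) 0ℓ} → Decidable Q → Series
PSeries Q? n i j l m = + countWhere (λ λs → InP? λs ×-dec Q? λs ×-dec Stat? n i j l m λs) (candidates n)

PSeries-cong : {Q Q' : Pred (List CInt) 0ℓ} (Q? : Decidable Q) (Q'? : Decidable Q') →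
  (∀ {λs} → InP λs → Q λs ⇔ Q' λs) → PSeries Q? ≈ PSeries Q'?
PSeries-cong Q? Q'? Q⇔Q' n i j l m = cong +_ (countWhere-≐ _ _
  ( (λ (ip , q , s) → ip , Equivalence.to (Q⇔Q' ip) q , s)
  , (λ (ip , q' , s) → ip , Equivalence.from (Q⇔Q' ip) q' , s))
  (candidates n))

PSeries-⊎ : {R Q Q' : Pred (List CInt) 0ℓ} (R? : Decidable R) (Q? : Decidable Q) (Q'? : Decidable Q') →
  (∀ {λs} → InP λs → R λs ⇔ (Q λs ⊎ Q' λs)) → (∀ {λs} → Q λs → Q' λs → ⊥) →
  PSeries R? ≈ PSeries Q? ⊕ PSeries Q'?
PSeries-⊎ R? Q? Q'? R⇔Q⊎Q' disjoint n i j l m = cong +_ (countWhere-⊎ _ _ _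
  ( (λ (ip , r , s) → Sum.map (λ q → ip , q , s) (λ q' → ip , q' , s) (Equivalence.to (R⇔Q⊎Q' ip) r))
  , [ (λ (ip , q , s) → ip , Equivalence.from (R⇔Q⊎Q' ip) (inj₁ q) , s)
    , (λ (ip , q' , s) → ip , Equivalence.from (R⇔Q⊎Q' ip) (inj₂ q') , s) ]′)
  (λ (_ , q , _) (_ , q' , _) → disjoint q q')
  (candidates n))

PSeries-empty : {Q : Pred (List CInt) 0ℓ} (Q? : Decidable Q) →
  (∀ {λs} → InP λs → ¬ Q λs) → PSeries Q? ≈ zeroS
PSeries-empty Q? ¬Q n i j l m = cong +_ (countWhere-none _ (λ λs (ip , q , _) → ¬Q ip q) (candidates n))

atMost-cover-split : ∀ {z⁻ z} → key z ≡ suc (key z⁻) →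
  ∀ λs → AtMost z λs ⇔ (AtMost z⁻ λs ⊎ Largest z λs)
atMost-cover-split {z⁻} {z} z≡1+z⁻ λs = mk⇔ (split λs) [ All.map (λ {q} → weaken {q}) , proj₁ ]′
  where
    weaken : ∀ {q} → q ≤ᶜ z⁻ → q ≤ᶜ z
    weaken q≤z⁻ = ≤-trans q≤z⁻ (≤-trans (n≤1+n (key z⁻)) (≤-reflexive (sym z≡1+z⁻)))
    split : ∀ λs → AtMost z λs → AtMost z⁻ λs ⊎ Largest z λs
    split [] [] = inj₁ []
    split (q ∷ r) (q≤z ∷ r≤z) with m≤n⇒m<n∨m≡n q≤z | split r r≤z
    ... | inj₂ q≡z | _                = inj₂ (q≤z ∷ r≤z , here q≡z)
    ... | inj₁ q<z | inj₁ r≤z⁻        = inj₁ (≤-pred (subst (key q <_) z≡1+z⁻ q<z) ∷ r≤z⁻)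
    ... | inj₁ _   | inj₂ (_ , z∈r)   = inj₂ (q≤z ∷ r≤z , there z∈r)

atMost-cover-disjoint : ∀ {z⁻ z} → key z ≡ suc (key z⁻) → ∀ {λs} → AtMost z⁻ λs → Largest z λs → ⊥
atMost-cover-disjoint z≡1+z⁻ λs≤z⁻ (_ , z∈λs) =
  All.lookupWith (λ q≤z⁻ q≡z → 1+n≰n (≤-trans (≤-reflexive (sym (trans q≡z z≡1+z⁻))) q≤z⁻)) λs≤z⁻ z∈λs

GPpos-step : ∀ z⁻ z → key z ≡ suc (key z⁻) → GPpos z ⊖ GPpos z⁻ ≈ EPpos z
GPpos-step z⁻ z z≡1+z⁻ n i j l m =
  trans (cong (_- GPpos z⁻ n i j l m) (split n i j l m))
        (+-cancel (GPpos z⁻ n i j l m) (EPpos z n i j l m))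
  where
    split : GPpos z ≈ GPpos z⁻ ⊕ EPpos z
    split = PSeries-⊎ (AtMost? z) (AtMost? z⁻) (Largest? z)
      (λ _ → atMost-cover-split {z⁻} {z} z≡1+z⁻ _) (atMost-cover-disjoint {z⁻} {z} z≡1+z⁻)
    +-cancel : ∀ x y → x ℤ.+ y - x ≡ y
    +-cancel = solve-∀

¬positive≤ᶜzero : ∀ {q} x → Positive q → ¬ q ≤ᶜ (0 , x)
¬positive≤ᶜzero {_ , y} x q>0 = <⇒≱ (key-<-value x y q>0)

GPpos-zero : ∀ x → GPpos (0 , x) ≈ one
GPpos-zero x zero zero    zero    zero    zero    = refl
GPpos-zero x zero zero    zero    zero    (suc m) = refl
GPpos-zero x zero zero    zero    (suc l) m       = refl
GPpos-zero x zero zero    (suc j) l       m       = refl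
GPpos-zero x zero (suc i) j       l       m       = refl
GPpos-zero x (suc n) i j l m = cong +_ (countWhere-none _ impossible (candidates (suc n)))
  where
    impossible : ∀ λs → ¬ (InP λs × AtMost (0 , x) λs × Stat (suc n) i j l m λs)
    impossible []      (_ , _ , () , _)
    impossible (q ∷ _) ((q>0 ∷ _ , _) , q≤0 ∷ _ , _) = ¬positive≤ᶜzero x q>0 q≤0

PSeries-head-single : ∀ z → PSeries (head? (sameKey? z)) ≈ EPpos z
PSeries-head-single z =
  PSeries-cong (head? (sameKey? z)) (Largest? z)
    (λ {λs} (_ , l) → mk⇔ (head⇒largest {z} λs l) (largest⇒head {z} λs l))

Head-∪ : ∀ {A B} λs → Head (A ∪ B) λs ⇔ (Head A λs ⊎ Head B λs)
Head-∪ []      = mk⇔ (λ ()) [ (λ ()) , (λ ()) ]′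
Head-∪ (_ ∷ _) = mk⇔ id id

PSeries-head-∪ : ∀ z₁ z₂ → key z₁ ≢ key z₂ →
  PSeries (head? (sameKey? z₁ ∪? sameKey? z₂)) ≈ EPpos z₁ ⊕ EPpos z₂
PSeries-head-∪ z₁ z₂ z₁≢z₂ = ≈-trans
  (PSeries-⊎ (head? (sameKey? z₁ ∪? sameKey? z₂)) (head? (sameKey? z₁)) (head? (sameKey? z₂))
     (λ {λs} _ → Head-∪ λs) (λ {λs} → disjoint {λs}))
  (⊕-cong (PSeries-head-single z₁) (PSeries-head-single z₂))
  where
    disjoint : ∀ {λs} → Head (SameKey z₁) λs → Head (SameKey z₂) λs → ⊥
    disjoint {_ ∷ _} q≡z₁ q≡z₂ = z₁≢z₂ (trans (sym q≡z₁) q≡z₂)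

PSeries-head-∅ : PSeries (head? ∅?) ≈ zeroS
PSeries-head-∅ = PSeries-empty (head? ∅?) λ { {_ ∷ _} _ () }

δ : Colour → Colour → ℕ
δ x y = if does (colIdx x ℕ.≟ colIdx y) then 1 else 0

count-∷ : ∀ x y {K} r → count y ((K , x) ∷ r) ≡ δ x y + count y r
count-∷ x y r with does (colIdx x ℕ.≟ colIdx y)
... | true  = refl
... | false = refl

+-≡⇔≡-∸ : ∀ {e c i} → e ≤ i → (e + c ≡ i) ⇔ (c ≡ i ∸ e)
+-≡⇔≡-∸ {e} {c} e≤i = mk⇔
  (λ e+c≡i → trans (sym (m+n∸m≡n e c)) (cong (_∸ e) e+c≡i))
  (λ c≡i∸e → trans (cong₂ _+_ refl c≡i∸e) (m+[n∸m]≡n e≤i))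

Stat-∷ : ∀ x r {K n i j l m} → K ≤ n → δ x ca ≤ i → δ x cb ≤ j → δ x cc ≤ l → δ x cd ≤ m →
  Stat n i j l m ((K , x) ∷ r) ⇔ Stat (n ∸ K) (i ∸ δ x ca) (j ∸ δ x cb) (l ∸ δ x cc) (m ∸ δ x cd) r
Stat-∷ x r {K} K≤n a b c d =
  +-≡⇔≡-∸ K≤n ×-⇔ count-shift ca a ×-⇔ count-shift cb b ×-⇔ count-shift cc c ×-⇔ count-shift cd d
  where
    count-shift : ∀ y {t} → δ x y ≤ t → (count y ((K , x) ∷ r) ≡ t) ⇔ (count y r ≡ t ∸ δ x y)
    count-shift y δ≤t rewrite count-∷ x y {K} r = +-≡⇔≡-∸ δ≤t

part-bounds : ∀ {K x} λs → Any (SameKey (K , x)) λs → K ≤ size λs × (∀ y → δ x y ≤ count y λs)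
part-bounds {K} {x} ((K' , x') ∷ r) (here e) with key-injective (K' , x') (K , x) e
... | refl = m≤m+n K (size r) ,
      λ y → ≤-trans (m≤m+n (δ x y) (count y r)) (≤-reflexive (sym (count-∷ x y r)))
part-bounds (q@(K' , x') ∷ r) (there p∈r) with part-bounds r p∈r
... | K≤size , δ≤count = ≤-trans K≤size (m≤n+m (size r) K') ,
      λ y → ≤-trans (δ≤count y)
                    (≤-trans (m≤n+m (count y r) (δ x' y)) (≤-reflexive (sym (count-∷ x' y r))))

gen-fuel : ∀ {f g} m → m ≤ f → m ≤ g → gen f m ≡ gen g m
gen-fuel zero _ _ = refl
gen-fuel {suc f} {suc g} (suc m) (s≤s m≤f) (s≤s m≤g) = concatMap-cong
  (λ v → cong (λ L → concatMap (λ y → map ((suc v , y) ∷_) L) allColours)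
              (gen-fuel (m ∸ v) (≤-trans (m∸n≤m m v) m≤f) (≤-trans (m∸n≤m m v) m≤g)))
  (upTo (suc m))

candidates-headed : ∀ {Q : Pred (List CInt) 0ℓ} (Q? : Decidable Q) {n k x} → k ≤ n →
  (∀ {λs} → Q λs → Head (SameKey (suc k , x)) λs) →
  countWhere Q? (candidates (suc n)) ≡ countWhere (λ r → Q? ((suc k , x) ∷ r)) (candidates (n ∸ k))
candidates-headed {Q} Q? {n} {k} {x} k≤n headed = begin
    countWhere Q? (concatMap G (upTo (suc n)))
  ≡⟨ countWhere-concatMap Q? G (upTo (suc n)) ⟩
    sum (map (countWhere Q? ∘′ G) (upTo (suc n)))
  ≡⟨ cong sum (map-applyUpTo id (countWhere Q? ∘′ G) (suc n)) ⟩
    sum (applyUpTo (countWhere Q? ∘′ G) (suc n))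
  ≡⟨ sum-applyUpTo-single (countWhere Q? ∘′ G) (s≤s k≤n) other-value ⟩
    countWhere Q? (G k)
  ≡⟨ countWhere-concatMap Q? (H k) allColours ⟩
    sum (map (countWhere Q? ∘′ H k) allColours)
  ≡⟨ sum-allColours-single (countWhere Q? ∘′ H k) x other-colour ⟩
    countWhere Q? (H k x)
  ≡⟨ countWhere-map Q? ((suc k , x) ∷_) (gen n (n ∸ k)) ⟩
    countWhere (λ r → Q? ((suc k , x) ∷ r)) (gen n (n ∸ k))
  ≡⟨ cong (countWhere (λ r → Q? ((suc k , x) ∷ r))) (gen-fuel (n ∸ k) (m∸n≤m n k) ≤-refl) ⟩
    countWhere (λ r → Q? ((suc k , x) ∷ r)) (gen (n ∸ k) (n ∸ k))
  ∎
  where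
    open ≡-Reasoning
    H : ℕ → Colour → List (List CInt)
    H v y = map ((suc v , y) ∷_) (gen n (n ∸ v))
    G : ℕ → List (List CInt)
    G v = concatMap (H v) allColours
    vanishes : ∀ v y → (suc v , y) ≢ (suc k , x) → countWhere Q? (H v y) ≡ 0
    vanishes v y ≢p = trans (countWhere-map Q? ((suc v , y) ∷_) (gen n (n ∸ v)))
      (countWhere-none _ (λ r q → ≢p (key-injective _ _ (headed q))) (gen n (n ∸ v)))
    other-value : ∀ v → v ≢ k → countWhere Q? (G v) ≡ 0
    other-value v v≢k = trans (countWhere-concatMap Q? (H v) allColours)
      (trans (sum-allColours-single (countWhere Q? ∘′ H v) ca (λ y _ → vanish y)) (vanish ca))
      where
        vanish : ∀ y → countWhere Q? (H v y) ≡ 0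
        vanish y = vanishes v y (v≢k ∘ suc-injective ∘ cong proj₁)
    other-colour : ∀ y → y ≢ x → countWhere Q? (H k y) ≡ 0
    other-colour y y≢x = vanishes k y (y≢x ∘ cong proj₂)

Extends : CInt → Pred (List CInt) 0ℓ
Extends p r = Linked Adj (p ∷ r)

extends? : ∀ p → Decidable (Extends p)
extends? p r = linked? Adj? (p ∷ r)

InP-∷ : ∀ {p r} → Positive p → InP (p ∷ r) ⇔ (InP r × Extends p r)
InP-∷ p>0 = mk⇔ (λ (ps>0 , l) → (All.tail ps>0 , Linked.tail l) , l)
                (λ ((r>0 , _) , l) → p>0 ∷ r>0 , l)

EPpos-in-range : ∀ k x n {i j l m} → suc k ≤ n → δ x ca ≤ i → δ x cb ≤ j → δ x cc ≤ l → δ x cd ≤ m →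
  EPpos (suc k , x) n i j l m
    ≡ PSeries (extends? (suc k , x)) (n ∸ suc k) (i ∸ δ x ca) (j ∸ δ x cb) (l ∸ δ x cc) (m ∸ δ x cd)
EPpos-in-range k x (suc n) {i} {j} {l} {m} (s≤s k≤n) a b c d = cong +_ (trans
    (candidates-headed _ k≤n (λ {λs} (ip , lg , _) → largest⇒head {p} λs (proj₂ ip) lg))
    (countWhere-≐ _ _ (to , from) (candidates (n ∸ k))))
  where
    p = (suc k , x)
    Stat′ = Stat (n ∸ k) (i ∸ δ x ca) (j ∸ δ x cb) (l ∸ δ x cc) (m ∸ δ x cd)
    to : ∀ {r} → InP (p ∷ r) × Largest p (p ∷ r) × Stat (suc n) i j l m (p ∷ r) →
      InP r × Extends p r × Stat′ r
    to {r} (ip , _ , s) with Equivalence.to (InP-∷ (s≤s z≤n)) ip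
    ... | ir , e = ir , e , Equivalence.to (Stat-∷ x r (s≤s k≤n) a b c d) s
    from : ∀ {r} → InP r × Extends p r × Stat′ r →
      InP (p ∷ r) × Largest p (p ∷ r) × Stat (suc n) i j l m (p ∷ r)
    from {r} (ir , e , s) =
      Equivalence.from (InP-∷ (s≤s z≤n)) (ir , e) , head⇒largest {p} (p ∷ r) e refl ,
      Equivalence.from (Stat-∷ x r (s≤s k≤n) a b c d) s

EPpos-out-of-range : ∀ k x {n i j l m} →
  ¬ (suc k ≤ n × δ x ca ≤ i × δ x cb ≤ j × δ x cc ≤ l × δ x cd ≤ m) →
  EPpos (suc k , x) n i j l m ≡ + 0
EPpos-out-of-range k x {n} {i} {j} {l} {m} out-of-range =
  cong +_ (countWhere-none _ counted⇒in-range (candidates n))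
  where
    counted⇒in-range : ∀ λs → ¬ (InP λs × Largest (suc k , x) λs × Stat n i j l m λs)
    counted⇒in-range λs (_ , (_ , p∈λs) , (s , sa , sb , sc , sd)) with part-bounds λs p∈λs
    ... | k<size , δ≤count = out-of-range (subst (suc k ≤_) s k<size ,
      subst (δ x ca ≤_) sa (δ≤count ca) , subst (δ x cb ≤_) sb (δ≤count cb) ,
      subst (δ x cc ≤_) sc (δ≤count cc) , subst (δ x cd ≤_) sd (δ≤count cd))

EPpos-cons : ∀ k x →
  EPpos (suc k , x) ≈ mon (suc k) (δ x ca) (δ x cb) (δ x cc) (δ x cd) (PSeries (extends? (suc k , x)))
EPpos-cons k x n i j l m =
  mon-intro (suc k) (δ x ca) (δ x cb) (δ x cc) (δ x cd) (PSeries (extends? (suc k , x))) n i j l m (EPpos-in-range k x n) (EPpos-out-of-range k x)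

record FollowerSplit (p : CInt) : Set₁ where
  field
    Top             : Pred CInt 0ℓ
    top?            : Decidable Top
    bound           : CInt
    follower-cases  : ∀ {q} → Positive q → Adj p q → Top q ⊎ q ≤ᶜ bound
    top-follows     : ∀ {q} → Top q → Adj p q
    bound-follows   : ∀ {q} → Positive q → q ≤ᶜ bound → Adj p q
    top-above-bound : ∀ {q} → Top q → ¬ q ≤ᶜ bound

PSeries-extends : ∀ {p} (S : FollowerSplit p) → let open FollowerSplit S in
  PSeries (extends? p) ≈ PSeries (head? top?) ⊕ GPpos bound
PSeries-extends {p} S =
  PSeries-⊎ (extends? p) (head? top?) (AtMost? bound) (λ {r} ir → mk⇔ (to r ir) (from r ir)) disjoint
  where
    open FollowerSplit S
    to : ∀ r → InP r → Extends p r → Head Top r ⊎ AtMost bound r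
    to [] _ _ = inj₂ []
    to (q ∷ r) (q>0 ∷ _ , l) (p→q ∷ _) = Sum.map₂ (atMost-∷ {bound} l) (follower-cases q>0 p→q)
    from : ∀ r → InP r → Head Top r ⊎ AtMost bound r → Extends p r
    from []      _               _             = [-]
    from (q ∷ r) (_ , l)         (inj₁ top)    = top-follows top ∷ l
    from (q ∷ r) (q>0 ∷ _ , l)   (inj₂ (q≤ ∷ _)) = bound-follows q>0 q≤ ∷ l
    disjoint : ∀ {r} → Head Top r → AtMost bound r → ⊥
    disjoint {_ ∷ _} top (q≤ ∷ _) = top-above-bound top q≤

EPpos-recurrence : ∀ {k x} (S : FollowerSplit (suc k , x)) {F} → let open FollowerSplit S in
  PSeries (head? top?) ⊕ GPpos bound ≈ F →
  EPpos (suc k , x) ≈ mon (suc k) (δ x ca) (δ x cb) (δ x cc) (δ x cd) F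
EPpos-recurrence {k} {x} S split≈F = ≈-trans (EPpos-cons k x)
  (mon-cong (suc k) (δ x ca) (δ x cb) (δ x cc) (δ x cd) (≈-trans (PSeries-extends S) split≈F))

SameKey-suc-≰ : ∀ k y w {q} → SameKey (suc k , y) q → ¬ q ≤ᶜ (k , w)
SameKey-suc-≰ k y w q≡ q≤ = <⇒≱ (key-<-value w y (n<1+n k)) (≤-trans (≤-reflexive (sym q≡)) q≤)

P-d≡P-c : ∀ y → P cd y ≡ P cc y
P-d≡P-c ca = refl
P-d≡P-c cb = refl
P-d≡P-c cc = refl
P-d≡P-c cd = refl

P-a≡1+P-b : ∀ y → P ca y ≡ suc (P cb y)
P-a≡1+P-b ca = refl
P-a≡1+P-b cb = refl
P-a≡1+P-b cc = refl
P-a≡1+P-b cd = refl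

cd-split : ∀ k x → (∀ y → P x y ≡ P cc y) → colIdx cc ≤ colIdx x → FollowerSplit (suc k , x)
cd-split k x Px≡Pc c≤x = record
  { Top             = SameKey (suc k , cc) ∪ SameKey (suc k , ca)
  ; top?            = sameKey? (suc k , cc) ∪? sameKey? (suc k , ca)
  ; bound           = (k , cc)
  ; follower-cases  = λ { {m' , y} _ (_ , gap) → cases y (subst (λ t → t + m' ≤ suc k) (Px≡Pc y) gap) }
  ; top-follows     = top-follows
  ; bound-follows   = λ { {m' , y} _ q≤ → ≤-trans q≤ (<⇒≤ (key-<-value cc x (n<1+n k))) ,
                          subst (λ t → t + m' ≤ suc k) (sym (Px≡Pc y)) (gap-ok y q≤) }
  ; top-above-bound = λ {q} → [ SameKey-suc-≰ k cc cc {q} , SameKey-suc-≰ k ca cc {q} ]′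
  }
  where
    Top = SameKey (suc k , cc) ∪ SameKey (suc k , ca)
    cases : ∀ {m'} y → P cc y + m' ≤ suc k → Top (m' , y) ⊎ (m' , y) ≤ᶜ (k , cc)
    cases ca m'≤ with m≤n⇒m<n∨m≡n m'≤
    ... | inj₁ (s≤s m'≤k) = inj₂ (≤ᶜ-mono ca cc m'≤k z≤n)
    ... | inj₂ refl       = inj₁ (inj₂ refl)
    cases cb (s≤s m'≤k) = inj₂ (≤ᶜ-mono cb cc m'≤k (s≤s z≤n))
    cases cc m'≤ with m≤n⇒m<n∨m≡n m'≤
    ... | inj₁ (s≤s m'≤k) = inj₂ (≤ᶜ-mono cc cc m'≤k ≤-refl)
    ... | inj₂ refl       = inj₁ (inj₁ refl)
    cases cd (s≤s m'<k) = inj₂ (<⇒≤ (key-<-value cd cc m'<k))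
    top-follows : ∀ {q} → Top q → Adj (suc k , x) q
    top-follows {q} (inj₁ q≡) with key-injective q (suc k , cc) q≡
    ... | refl = +-monoʳ-≤ (4 * suc k) c≤x , ≤-reflexive (cong (_+ suc k) (Px≡Pc cc))
    top-follows {q} (inj₂ q≡) with key-injective q (suc k , ca) q≡
    ... | refl = +-monoʳ-≤ (4 * suc k) z≤n , ≤-reflexive (cong (_+ suc k) (Px≡Pc ca))
    gap-ok : ∀ {m'} y → (m' , y) ≤ᶜ (k , cc) → P cc y + m' ≤ suc k
    gap-ok {m'} ca q≤ = m≤n⇒m≤1+n (≤ᶜ⇒≤ m' ca k cc q≤)
    gap-ok {m'} cb q≤ = s≤s (≤ᶜ⇒≤ m' cb k cc q≤)
    gap-ok {m'} cc q≤ = m≤n⇒m≤1+n (≤ᶜ⇒≤ m' cc k cc q≤)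
    gap-ok {m'} cd q≤ with ≤ᶜ-inv m' cd k cc q≤
    ... | inj₁ m'<k                 = s≤s m'<k
    ... | inj₂ (_ , s≤s (s≤s ()))

b-followers : ∀ {k m'} y → P cb y + m' ≤ suc k → SameKey (suc k , cb) (m' , y) ⊎ (m' , y) ≤ᶜ (k , cd)
b-followers cb m'≤ with m≤n⇒m<n∨m≡n m'≤
... | inj₁ (s≤s m'≤k) = inj₂ (≤ᶜ-mono cb cd m'≤k (s≤s z≤n))
... | inj₂ refl       = inj₁ refl
b-followers ca (s≤s m'≤k) = inj₂ (≤ᶜ-mono ca cd m'≤k z≤n)
b-followers cc (s≤s m'≤k) = inj₂ (≤ᶜ-mono cc cd m'≤k (s≤s (s≤s z≤n)))
b-followers cd (s≤s m'≤k) = inj₂ (≤ᶜ-mono cd cd m'≤k ≤-refl)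

b-gap : ∀ {k m'} y → m' ≤ k → P cb y + m' ≤ suc k
b-gap ca m'≤k = s≤s m'≤k
b-gap cb m'≤k = m≤n⇒m≤1+n m'≤k
b-gap cc m'≤k = s≤s m'≤k
b-gap cd m'≤k = s≤s m'≤k

b-split : ∀ k → FollowerSplit (suc k , cb)
b-split k = record
  { Top             = SameKey (suc k , cb)
  ; top?            = sameKey? (suc k , cb)
  ; bound           = (k , cd)
  ; follower-cases  = λ { {_ , y} _ (_ , gap) → b-followers y gap }
  ; top-follows     = λ { {q} q≡ → case key-injective q (suc k , cb) q≡ of
                          λ { refl → ≤-refl , ≤-refl } }
  ; bound-follows   = λ { {m' , y} _ q≤ → ≤-trans q≤ (<⇒≤ (key-<-value cd cb (n<1+n k))) ,
                          b-gap y (≤ᶜ⇒≤ m' y k cd q≤) }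
  ; top-above-bound = λ {q} → SameKey-suc-≰ k cb cd {q}
  }

a-split : ∀ k → FollowerSplit (suc (suc k) , ca)
a-split k = record
  { Top             = SameKey (suc k , cb)
  ; top?            = sameKey? (suc k , cb)
  ; bound           = (k , cd)
  ; follower-cases  = λ { {m' , y} _ (_ , gap) →
                          b-followers y (≤-pred (subst (λ t → t + m' ≤ suc (suc k)) (P-a≡1+P-b y) gap)) }
  ; top-follows     = λ { {q} q≡ → case key-injective q (suc k , cb) q≡ of
                          λ { refl → <⇒≤ (key-<-value cb ca (n<1+n (suc k))) , ≤-refl } }
  ; bound-follows   = λ { {m' , y} _ q≤ → ≤-trans q≤ (<⇒≤ (key-<-value cd ca (m<n⇒m<1+n (n<1+n k)))) ,
                          subst (λ t → t + m' ≤ suc (suc k)) (sym (P-a≡1+P-b y))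
                                (s≤s (b-gap y (≤ᶜ⇒≤ m' y k cd q≤))) }
  ; top-above-bound = λ {q} → SameKey-suc-≰ k cb cd {q}
  }

a1-split : FollowerSplit (1 , ca)
a1-split = record
  { Top             = ∅
  ; top?            = ∅?
  ; bound           = (0 , cd)
  ; follower-cases  = λ { {suc _ , ca} _ (_ , s≤s ()) ; {suc _ , cb} _ (_ , s≤s ())
                        ; {suc _ , cc} _ (_ , s≤s ()) ; {suc _ , cd} _ (_ , s≤s ()) }
  ; top-follows     = λ ()
  ; bound-follows   = λ q>0 q≤ → ⊥-elim (¬positive≤ᶜzero cd q>0 q≤)
  ; top-above-bound = λ ()
  }

GP-nonneg : ∀ k x → x ≢ ca → GP (+ k) x ≈ GPpos (k , x)
GP-nonneg zero    ca x≢a = ⊥-elim (x≢a refl)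
GP-nonneg zero    cb _   = ≈-sym (GPpos-zero cb)
GP-nonneg zero    cc _   = ≈-sym (GPpos-zero cc)
GP-nonneg zero    cd _   = ≈-sym (GPpos-zero cd)
GP-nonneg (suc k) x  _   = ≈-refl

key-next-colour : ∀ m x y → colIdx y ≡ suc (colIdx x) → key (m , y) ≡ suc (key (m , x))
key-next-colour m x y e = trans (cong₂ _+_ refl e) (+-suc (4 * m) (colIdx x))

key-next-value : ∀ m → key (suc m , ca) ≡ suc (key (m , cd))
key-next-value m = begin
    4 * suc m + 0  ≡⟨ +-identityʳ (4 * suc m) ⟩
    4 * suc m      ≡⟨ *-suc 4 m ⟩
    4 + 4 * m      ≡⟨ +-comm 4 (4 * m) ⟩
    4 * m + 4      ≡⟨ +-suc (4 * m) 3 ⟩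
    suc (4 * m + 3) ∎
  where open ≡-Reasoning

EP-a-recurrence : ∀ k →
  EP (+ suc k) ca ≈ mon (suc k) 1 0 0 0 (EP (+ suc k - + 1) cb ⊕ GP (+ suc k - + 2) cd)
-- 1_a has no followers, so the bracket is 0 + 1, which the conventions write as b + (1 − b).
EP-a-recurrence zero = EPpos-recurrence a1-split
  (≈-trans (⊕-cong PSeries-head-∅ (GPpos-zero cd))
           (λ n i j l m → b+[1-b] (bSer n i j l m) (one n i j l m)))
  where
    b+[1-b] : ∀ b o → + 0 ℤ.+ o ≡ b ℤ.+ (o - b)
    b+[1-b] = solve-∀
EP-a-recurrence (suc k) = EPpos-recurrence (a-split k)
  (⊕-cong (PSeries-head-single (suc k , cb)) (≈-sym (GP-nonneg k cd λ ())))

lemma2p3 : (k : ℕ) → 1 ≤ k →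
    ((GP (+ k) cd ⊖ GP (+ k) cc ≈ EP (+ k) cd)
      × (EP (+ k) cd ≈ mon k 0 0 0 1 (EP (+ k) cc ⊕ EP (+ k) ca ⊕ GP (+ k - + 1) cc)))
    × ((GP (+ k) cc ⊖ GP (+ k) cb ≈ EP (+ k) cc)
      × (EP (+ k) cc ≈ mon k 0 0 1 0 (EP (+ k) cc ⊕ EP (+ k) ca ⊕ GP (+ k - + 1) cc)))
    × ((GP (+ k) cb ⊖ GP (+ k) ca ≈ EP (+ k) cb)
      × (EP (+ k) cb ≈ mon k 0 1 0 0 (EP (+ k) cb ⊕ GP (+ k - + 1) cd)))
    × ((GP (+ k) ca ⊖ GP (+ k - + 1) cd ≈ EP (+ k) ca)
      × (EP (+ k) ca ≈ mon k 1 0 0 0 (EP (+ k - + 1) cb ⊕ GP (+ k - + 2) cd)))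
lemma2p3 (suc k) _ =
    ( GPpos-step (suc k , cc) (suc k , cd) (key-next-colour (suc k) cc cd refl)
    , EPpos-recurrence (cd-split k cd P-d≡P-c (s≤s (s≤s z≤n))) c-or-a )
  , ( GPpos-step (suc k , cb) (suc k , cc) (key-next-colour (suc k) cb cc refl)
    , EPpos-recurrence (cd-split k cc (λ _ → refl) ≤-refl) c-or-a )
  , ( GPpos-step (suc k , ca) (suc k , cb) (key-next-colour (suc k) ca cb refl)
    , EPpos-recurrence (b-split k) (⊕-cong (PSeries-head-single (suc k , cb)) (≈-sym GP-k-d)) )
  , ( ≈-trans (⊖-congʳ {GPpos (suc k , ca)} GP-k-d)
              (GPpos-step (k , cd) (suc k , ca) (key-next-value k))
    , EP-a-recurrence k )
  where
    GP-k-d : GP (+ k) cd ≈ GPpos (k , cd)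
    GP-k-d = GP-nonneg k cd λ ()
    c≢a : key (suc k , cc) ≢ key (suc k , ca)
    c≢a e = case key-injective (suc k , cc) (suc k , ca) e of λ ()
    c-or-a : PSeries (head? (sameKey? (suc k , cc) ∪? sameKey? (suc k , ca))) ⊕ GPpos (k , cc)
             ≈ EPpos (suc k , cc) ⊕ EPpos (suc k , ca) ⊕ GP (+ k) cc
    c-or-a = ⊕-cong (PSeries-head-∪ (suc k , cc) (suc k , ca) c≢a) (≈-sym (GP-nonneg k cc λ ()))
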